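{- For any finite word $w$ and $z\in\mathrm{Lyn}(w)$ with $|\mathrm{CS}_w(z)|\ge1$, one has $\mathrm{avg}_w(z)\le\frac{|z|}{|z|+1}$.
   Context: Fix a total order on letters and the induced lexicographic order. A square is a word $xx$ with $x$ non-empty; $\mathrm{Sq}(w)$ is the set of distinct squares that are factors of $w$. $F(w)$ is the set of factors of $w$ (including the empty word), $F_w(\ell)$ those of length $\ell$. For non-empty $z$, $[z]=\{z[i..|z|]z[1..i-1]:1\le i\le|z|\}$; for non-empty $x$ and $m\ge0$, $x^{m/|x|}$ is the length-$m$ prefix of $xxx\cdots$, and $[z]_m=\{x^{m/|x|}:x\in[z]\}$. A Lyndon word is a primitive word that is lexicographically smallest in its conjugacy class; $\mathrm{Lyn}(w)$ is the set of Lyndon factors of $w$. For $z\in\mathrm{Lyn}(w)$, $\mathrm{Sq}_w(z)=\{x^{2r}\in\mathrm{Sq}(w): x\in[z],\ r\ge1\}$. The Rauzy graph $\Gamma_w(\ell)$ is the directed multigraph with vertex set $F_w(\ell)$ and arc set $F_w(\ell+1)$, arc $u$ going from $u[1..\ell]$ to $u[2..\ell+1]$; $\Gamma_w$ is the disjoint union of $\Gamma_w(\ell)$, $0\le\ell\le|w|$. $\mathrm{CS}_w(z)$ is the set of circuits of $\Gamma_w$ whose arc set equals $[z]_m$ for some integer $m\ge|z|$ (one circuit for each such $m$ with $[z]_m\subseteq F(w)$; cyclic rotations are not distinguished). When $|\mathrm{CS}_w(z)|\ge1$, $\mathrm{avg}_w(z)=|\mathrm{Sq}_w(z)|/|\mathrm{CS}_w(z)|$.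 -}

module Defs where

open import Data.Nat using (ℕ; zero; suc; _+_; _*_; _≤_; _<_; _≤?_)
open import Data.List using (List; []; _∷_; _++_; length; take; drop; concat; replicate;
  map; concatMap; filter; upTo; deduplicate; inits; tails)
open import Data.List.Properties using (≡-dec)
open import Data.List.Relation.Binary.Lex.Core using (Lex-≤)
open import Data.List.Relation.Unary.All using (All; all?)
open import Data.List.Membership.DecPropositional using () renaming (_∈?_ to mem?)
open import Data.Product using (∃₂; _×_)
open import Relation.Binary.Definitions using (DecidableEquality)
open import Relation.Binary.Structures using (IsStrictTotalOrder)
open import Relation.Binary.PropositionalEquality using (_≡_; _≢_)
open import Relation.Nullary.Decidable using (_×-dec_)

module Words {A : Set} (_≺_ : A → A → Set) (sto : IsStrictTotalOrder _≡_ _≺_) where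

  Word : Set
  Word = List A

  _≟_ : DecidableEquality Word
  _≟_ = ≡-dec (IsStrictTotalOrder._≟_ sto)

  IsFactor : Word → Word → Set
  IsFactor u w = ∃₂ λ p s → w ≡ p ++ u ++ s

  -- F(w), as a list (every factor, possibly with repetitions)
  F : Word → List Word
  F w = concatMap inits (tails w)

  rot : Word → ℕ → Word
  rot z i = drop i z ++ take i z

  -- [z] = conjugacy class of z, as the list of its |z| rotations
  conj : Word → List Word
  conj z = map (rot z) (upTo (length z))

  -- x^{m/|x|} : length-m prefix of x x x ...
  pw : Word → ℕ → Word
  pw x m = take m (concat (replicate m x))

  Primitive : Word → Set
  Primitive z = ∀ (u : Word) (k : ℕ) → 2 ≤ k → z ≢ concat (replicate k u)

  _≤lex_ : Word → Word → Set
  _≤lex_ = Lex-≤ _≡_ _≺_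

  IsLyndon : Word → Set
  IsLyndon z = z ≢ [] × Primitive z × (∀ i → i < length z → z ≤lex rot z i)

  IsLyndonFactor : Word → Word → Set
  IsLyndonFactor w z = IsLyndon z × IsFactor z w

  -- Sq_w(z) = { x^{2r} ∈ Sq(w) : x ∈ [z], r ≥ 1 } as a duplicate-free list.
  -- (x^{2r} can only be a factor of w if 2r|x| ≤ |w|, so r ≤ |w| suffices.)
  Sqw : Word → Word → List Word
  Sqw w z = deduplicate _≟_
    (filter (λ u → mem? _≟_ u (F w))
      (concatMap (λ r → map (λ x → pw x (2 * suc r * length x)) (conj z))
                 (upTo (length w))))

  sqCount : Word → Word → ℕ
  sqCount w z = length (Sqw w z)

  ConjPowFactors? : (w z : Word) (m : ℕ) → _
  ConjPowFactors? w z m = all? (λ x → mem? _≟_ (pw x m) (F w)) (conj z)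

  -- |CS_w(z)| = number of integers m ≥ |z| with [z]_m ⊆ F(w)
  -- (one circuit of Γ_w(m-1) per such m; for non-empty z such m satisfy m ≤ |w|).
  csCount : Word → Word → ℕ
  csCount w z = length (filter (λ m → (length z ≤? m) ×-dec ConjPowFactors? w z m)
                               (upTo (suc (length w))))

module Submission where

-- Let n = |z| and let k_r count the conjugates x of z with x^{2(r+1)} a factor of w. All these
-- powers are windows of the periodic word z z z ⋯. If R is maximal with k_R > 0, then
-- |Sq_w(z)| ≤ R n + k_R. On the other hand the k_R occurring windows of length 2(R+1)n start at
-- k_R of the n residues mod n, so every residue lies within cyclic distance n − k_R after one of
-- them, and every window of length m ≤ n + 2Rn + k_R occurs in w. Hence [z]_m ⊆ F(w) for
-- m = n, …, n + 2Rn + k_R, so |CS_w(z)| ≥ 2Rn + k_R + 1, and the two bounds give the ratio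
-- n / (n + 1).

open import Defs
open import Data.Bool using (Bool; true; false; if_then_else_)
open import Data.Empty using (⊥-elim)
open import Data.List using (List; []; _∷_; _++_; length; take; drop; concat; replicate;
  map; concatMap; filter; applyUpTo; upTo; inits; tails)
open import Data.List.Properties using (length-++; ++-assoc; filter-++; length-applyUpTo;
  map-upTo; map-applyUpTo; map-cong; length-deduplicate)
open import Data.List.Membership.DecPropositional using () renaming (_∈?_ to mem?)
open import Data.List.Membership.Propositional using (_∈_; find)
open import Data.List.Membership.Propositional.Properties
  using (∈-map⁺; ∈-map⁻; ∈-concatMap⁺; ∈-concatMap⁻)
open import Data.List.Relation.Unary.All using (All)
open import Data.List.Relation.Unary.All.Properties using (applyUpTo⁺₁)
open import Data.List.Relation.Unary.Any using (here; there)
import Data.List.Relation.Unary.Any as Any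
open import Data.Nat using (ℕ; zero; suc; _+_; _*_; _∸_; _≤_; _<_; z≤n; s≤s; NonZero)
open import Data.Nat.DivMod using (_%_; m%n%n≡m%n; [m+n]%n≡m%n; n%n≡0; m<n⇒m%n≡m; %-distribˡ-+)
open import Data.Nat.ListAction using (sum)
open import Data.Nat.Properties hiding (_≟_)
open import Data.Nat.Tactic.RingSolver using (solve-∀)
open import Data.Product using (∃-syntax; _×_; _,_)
open import Data.Sum using (_⊎_; inj₁; inj₂)
open import Function using (_∘_)
open import Relation.Binary.Structures using (IsStrictTotalOrder)
open import Relation.Binary.PropositionalEquality
open import Relation.Nullary using (Dec; yes; does)
open import Relation.Nullary.Decidable using (dec-true; _×-dec_)
open import Relation.Unary using (Decidable)

boolToℕ : Bool → ℕ
boolToℕ b = if b then 1 else 0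

count : (ℕ → Bool) → ℕ → ℕ
count c zero    = 0
count c (suc n) = boolToℕ (c 0) + count (c ∘ suc) n

count≤ : ∀ c n → count c n ≤ n
count≤ c zero    = z≤n
count≤ c (suc n) with c 0
... | true  = s≤s (count≤ (c ∘ suc) n)
... | false = m≤n⇒m≤1+n (count≤ (c ∘ suc) n)

count-cong : ∀ {c c′} n → (∀ i → i < n → c i ≡ c′ i) → count c n ≡ count c′ n
count-cong zero    _  = refl
count-cong (suc n) eq =
  cong₂ _+_ (cong boolToℕ (eq 0 (s≤s z≤n))) (count-cong n (λ i i<n → eq (suc i) (s≤s i<n)))

count-suc : ∀ c n → count c (suc n) ≡ count c n + boolToℕ (c n)
count-suc c zero    = +-comm (boolToℕ (c 0)) 0
count-suc c (suc n) = trans (cong (boolToℕ (c 0) +_) (count-suc (c ∘ suc) n))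
                            (sym (+-assoc (boolToℕ (c 0)) (count (c ∘ suc) n) _))

count-rotate : ∀ c n .{{_ : NonZero n}} q → count (λ e → c ((q + e) % n)) n ≡ count c n
count-rotate c n zero    = count-cong n (λ i i<n → cong c (m<n⇒m%n≡m i<n))
count-rotate c n@(suc n′) (suc q) = trans rotate-once (count-rotate c n q)
  where
  open ≡-Reasoning
  c′ : ℕ → Bool
  c′ e = c ((q + e) % n)
  rotate-once : count (λ e → c ((suc q + e) % n)) n ≡ count c′ n
  rotate-once = begin
    count (λ e → c ((suc q + e) % n)) n
      ≡⟨ count-suc _ n′ ⟩
    count (λ e → c ((suc q + e) % n)) n′ + boolToℕ (c ((suc q + n′) % n))
      ≡⟨ cong₂ _+_ (count-cong n′ (λ i _ → cong (λ j → c (j % n)) (sym (+-suc q i))))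
                   (cong (boolToℕ ∘ c) (last≡first)) ⟩
    count (c′ ∘ suc) n′ + boolToℕ (c′ 0)
      ≡⟨ +-comm (count (c′ ∘ suc) n′) _ ⟩
    count c′ n ∎
    where
    last≡first : (suc q + n′) % n ≡ (q + 0) % n
    last≡first = begin
      (suc q + n′) % n ≡⟨ cong (_% n) (sym (+-suc q n′)) ⟩
      (q + n) % n      ≡⟨ [m+n]%n≡m%n q n ⟩
      q % n            ≡⟨ cong (_% n) (sym (+-identityʳ q)) ⟩
      (q + 0) % n      ∎

run≤count : ∀ c a l n → (∀ j → j < l → c (a + j) ≡ true) → a + l ≤ n → l ≤ count c n
run≤count c zero    zero    n       _   _           = z≤n
run≤count c zero    (suc l) (suc n) run (s≤s l≤n)   rewrite run 0 (s≤s z≤n) =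
  s≤s (run≤count (c ∘ suc) zero l n (λ j j<l → run (suc j) (s≤s j<l)) l≤n)
run≤count c (suc a) l       (suc n) run (s≤s a+l≤n) =
  ≤-trans (run≤count (c ∘ suc) a l n run a+l≤n) (m≤n+m _ (boolToℕ (c 0)))

count>⇒∃true≥ : ∀ c n a → a < count c n → ∃[ e ] a ≤ e × e < n × c e ≡ true
count>⇒∃true≥ c (suc n) a a<count with c 0 in c0
count>⇒∃true≥ c (suc n) zero    _             | true =  0 , z≤n , s≤s z≤n , c0
count>⇒∃true≥ c (suc n) (suc a) (s≤s a<count) | true
  with e , a≤e , e<n , ce ← count>⇒∃true≥ (c ∘ suc) n a a<count =
    suc e , s≤s a≤e , s≤s e<n , ce
count>⇒∃true≥ c (suc n) a       a<count       | false
  with e , a≤e , e<n , ce ← count>⇒∃true≥ (c ∘ suc) n a a<count =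
    suc e , m≤n⇒m≤1+n a≤e , s≤s e<n , ce

module _ {B : Set} {P : B → Set} (P? : Decidable P) where

  length-filter-applyUpTo : ∀ f n → length (filter P? (applyUpTo f n)) ≡ count (does ∘ P? ∘ f) n
  length-filter-applyUpTo f zero    = refl
  length-filter-applyUpTo f (suc n) with does (P? (f 0))
  ... | true  = cong suc (length-filter-applyUpTo (f ∘ suc) n)
  ... | false = length-filter-applyUpTo (f ∘ suc) n

  length-filter-concatMap : ∀ {C : Set} (h : C → List B) xs →
    length (filter P? (concatMap h xs)) ≡ sum (map (length ∘ filter P? ∘ h) xs)
  length-filter-concatMap h []       = refl
  length-filter-concatMap h (x ∷ xs) = begin
    length (filter P? (h x ++ concatMap h xs))
      ≡⟨ cong length (filter-++ P? (h x) (concatMap h xs)) ⟩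
    length (filter P? (h x) ++ filter P? (concatMap h xs))
      ≡⟨ length-++ (filter P? (h x)) ⟩
    length (filter P? (h x)) + length (filter P? (concatMap h xs))
      ≡⟨ cong (length (filter P? (h x)) +_) (length-filter-concatMap h xs) ⟩
    length (filter P? (h x)) + sum (map (length ∘ filter P? ∘ h) xs) ∎
    where open ≡-Reasoning

sum-≤-last-positive : ∀ (G : ℕ → ℕ) {b} N → (∀ r → G r ≤ b) →
  sum (applyUpTo G N) ≡ 0 ⊎ ∃[ R ] 1 ≤ G R × sum (applyUpTo G N) ≤ R * b + G R
sum-≤-last-positive G zero    _   = inj₁ refl
sum-≤-last-positive G {b} (suc N) G≤b with sum-≤-last-positive (G ∘ suc) N (G≤b ∘ suc)
... | inj₂ (R , 1≤GR , sum≤) =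
  inj₂ (suc R , 1≤GR , ≤-trans (+-mono-≤ (G≤b 0) sum≤) (≤-reflexive (sym (+-assoc b (R * b) _))))
... | inj₁ sum≡0 with G 0 in G0
...   | zero  = inj₁ sum≡0
...   | suc g = inj₂ (0 , subst (1 ≤_) (sym G0) (s≤s z≤n) , ≤-reflexive last≡sum)
  where
  last≡sum : suc g + sum (applyUpTo (G ∘ suc) N) ≡ G 0
  last≡sum = trans (cong (suc g +_) sum≡0) (trans (+-identityʳ (suc g)) (sym G0))

module _ {A : Set} where

  applyUpTo-cong : ∀ {f g : ℕ → A} n → (∀ i → i < n → f i ≡ g i) → applyUpTo f n ≡ applyUpTo g n
  applyUpTo-cong zero    _  = refl
  applyUpTo-cong (suc n) eq =
    cong₂ _∷_ (eq 0 (s≤s z≤n)) (applyUpTo-cong n (λ i i<n → eq (suc i) (s≤s i<n)))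

  applyUpTo-++ : ∀ (f : ℕ → A) a b → applyUpTo f (a + b) ≡ applyUpTo f a ++ applyUpTo (f ∘ (a +_)) b
  applyUpTo-++ f zero    b = refl
  applyUpTo-++ f (suc a) b = cong (f 0 ∷_) (applyUpTo-++ (f ∘ suc) a b)

  take-applyUpTo : ∀ (f : ℕ → A) {m n} → m ≤ n → take m (applyUpTo f n) ≡ applyUpTo f m
  take-applyUpTo f {zero}            _         = refl
  take-applyUpTo f {suc m} {suc n} (s≤s m≤n) = cong (f 0 ∷_) (take-applyUpTo (f ∘ suc) m≤n)

  drop-applyUpTo : ∀ (f : ℕ → A) a b → drop a (applyUpTo f (a + b)) ≡ applyUpTo (f ∘ (a +_)) b
  drop-applyUpTo f zero    b = refl
  drop-applyUpTo f (suc a) b = drop-applyUpTo (f ∘ suc) a b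

  nth : A → List A → ℕ → A
  nth d []       _       = d
  nth d (x ∷ xs) zero    = x
  nth d (x ∷ xs) (suc i) = nth d xs i

  applyUpTo-nth : ∀ d xs → applyUpTo (nth d xs) (length xs) ≡ xs
  applyUpTo-nth d []       = refl
  applyUpTo-nth d (x ∷ xs) = cong (x ∷_) (applyUpTo-nth d xs)

does≡true⇒ : ∀ {P : Set} (P? : Dec P) → does P? ≡ true → P
does≡true⇒ (yes p) _ = p

mod-+-cong : ∀ x y i n .{{_ : NonZero n}} → x % n ≡ y % n → (x + i) % n ≡ (y + i) % n
mod-+-cong x y i n x≡y = begin
  (x + i) % n             ≡⟨ %-distribˡ-+ x i n ⟩
  (x % n + i % n) % n     ≡⟨ cong (λ r → (r + i % n) % n) x≡y ⟩
  (y % n + i % n) % n     ≡⟨ %-distribˡ-+ y i n ⟨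
  (y + i) % n             ∎
  where open ≡-Reasoning

-- Applied with X = R n and k = k_R.
ratio-bound : ∀ {n X k sq cs} .{{_ : NonZero n}} → k ≤ n → sq ≤ X + k → X + X + k < cs →
              sq * (n + 1) ≤ n * cs
ratio-bound {n} {X} {k} {sq} {cs} k≤n sq≤X+k X+X+k<cs = begin
  sq * (n + 1)                 ≤⟨ *-monoˡ-≤ (n + 1) sq≤X+k ⟩
  (X + k) * (n + 1)            ≡⟨ expand X k n ⟩
  X * n + k * n + (X + k)      ≤⟨ +-monoʳ-≤ (X * n + k * n) (+-mono-≤ (m≤m*n X n) k≤n) ⟩
  X * n + k * n + (X * n + n)  ≡⟨ collect X k n ⟩
  n * suc (X + X + k)          ≤⟨ *-monoʳ-≤ n X+X+k<cs ⟩
  n * cs                       ∎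
  where
  open ≤-Reasoning
  expand : ∀ X k n → (X + k) * (n + 1) ≡ X * n + k * n + (X + k)
  expand = solve-∀
  collect : ∀ X k n → X * n + k * n + (X * n + n) ≡ n * suc (X + X + k)
  collect = solve-∀

module _ {A : Set} (_≺_ : A → A → Set) (sto : IsStrictTotalOrder _≡_ _≺_) where
  open Words _≺_ sto

  ∈-inits⁺ : ∀ (u s : Word) → u ∈ inits (u ++ s)
  ∈-inits⁺ []      s = here refl
  ∈-inits⁺ (x ∷ u) s = there (∈-map⁺ (x ∷_) (∈-inits⁺ u s))

  ∈-inits⁻ : ∀ {u} (v : Word) → u ∈ inits v → ∃[ s ] v ≡ u ++ s
  ∈-inits⁻ v (here refl) = v , refl
  ∈-inits⁻ (x ∷ v) (there u∈)
    with u′ , u′∈ , refl ← ∈-map⁻ (x ∷_) u∈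
    with s , refl ← ∈-inits⁻ v u′∈ = s , refl

  ∈-tails⁺ : ∀ (p t : Word) → t ∈ tails (p ++ t)
  ∈-tails⁺ []      t = here refl
  ∈-tails⁺ (x ∷ p) t = there (∈-tails⁺ p t)

  ∈-tails⁻ : ∀ {t} (v : Word) → t ∈ tails v → ∃[ p ] v ≡ p ++ t
  ∈-tails⁻ v (here refl) = [] , refl
  ∈-tails⁻ (x ∷ v) (there t∈) with p , refl ← ∈-tails⁻ v t∈ = x ∷ p , refl

  IsFactor⇒∈F : ∀ {u w} → IsFactor u w → u ∈ F w
  IsFactor⇒∈F {u} (p , s , refl) =
    ∈-concatMap⁺ inits (Any.map (λ { refl → ∈-inits⁺ u s }) (∈-tails⁺ p (u ++ s)))

  ∈F⇒IsFactor : ∀ {u} w → u ∈ F w → IsFactor u w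
  ∈F⇒IsFactor w u∈
    with t , t∈ , u∈inits ← find (∈-concatMap⁻ inits {xs = tails w} u∈)
    with p , refl ← ∈-tails⁻ w t∈
    with s , refl ← ∈-inits⁻ t u∈inits = p , s , refl

  IsFactor-trans : ∀ {u v w} → IsFactor u v → IsFactor v w → IsFactor u w
  IsFactor-trans {u} (p , s , refl) (p′ , s′ , refl) = p′ ++ p , s ++ s′ , (begin
    p′ ++ (p ++ u ++ s) ++ s′   ≡⟨ cong (p′ ++_) (++-assoc p (u ++ s) s′) ⟩
    p′ ++ p ++ (u ++ s) ++ s′   ≡⟨ cong (λ r → p′ ++ p ++ r) (++-assoc u s s′) ⟩
    p′ ++ p ++ u ++ s ++ s′     ≡⟨ ++-assoc p′ p (u ++ s ++ s′) ⟨
    (p′ ++ p) ++ u ++ s ++ s′   ∎)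
    where open ≡-Reasoning

  IsFactor⇒length≤ : ∀ {u w} → IsFactor u w → length u ≤ length w
  IsFactor⇒length≤ {u} (p , s , refl) = begin
    length u                          ≤⟨ m≤m+n (length u) (length s) ⟩
    length u + length s               ≤⟨ m≤n+m _ (length p) ⟩
    length p + (length u + length s)  ≡⟨ cong (length p +_) (length-++ u) ⟨
    length p + length (u ++ s)        ≡⟨ length-++ p ⟨
    length (p ++ u ++ s)              ∎
    where open ≤-Reasoning

  applyUpTo-infix : ∀ (f : ℕ → A) {d m M} → d + m ≤ M →
                    IsFactor (applyUpTo (f ∘ (d +_)) m) (applyUpTo f M)
  applyUpTo-infix f {d} {m} d+m≤M with r , refl ← m≤n⇒∃[o]m+o≡n d+m≤M =
    applyUpTo f d , applyUpTo (λ i → f (d + (m + i))) r , (begin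
      applyUpTo f (d + m + r)
        ≡⟨ cong (applyUpTo f) (+-assoc d m r) ⟩
      applyUpTo f (d + (m + r))
        ≡⟨ applyUpTo-++ f d (m + r) ⟩
      applyUpTo f d ++ applyUpTo (f ∘ (d +_)) (m + r)
        ≡⟨ cong (applyUpTo f d ++_) (applyUpTo-++ (f ∘ (d +_)) m r) ⟩
      applyUpTo f d ++ applyUpTo (f ∘ (d +_)) m ++ applyUpTo (λ i → f (d + (m + i))) r ∎)
    where open ≡-Reasoning

  module SquaresOfConjugates (w : Word) (a : A) (as : Word) where

    z : Word
    z = a ∷ as

    n : ℕ
    n = length z

    -- ω is the infinite periodic word z z z ⋯, so that rot z s and its powers are windows of ω
    ω : ℕ → A
    ω i = nth a z (i % n)

    window : ℕ → ℕ → Word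
    window x m = applyUpTo (ω ∘ (x +_)) m

    window-mod : ∀ x y m → x % n ≡ y % n → window x m ≡ window y m
    window-mod x y m x≡y = applyUpTo-cong m (λ i _ → cong (nth a z) (mod-+-cong x y i n x≡y))

    window-++ : ∀ x k l → window x (k + l) ≡ window x k ++ window (x + k) l
    window-++ x k l = trans (applyUpTo-++ (ω ∘ (x +_)) k l)
      (cong (window x k ++_) (applyUpTo-cong l (λ i _ → cong ω (sym (+-assoc x k i)))))

    window-0 : window 0 n ≡ z
    window-0 =
      trans (applyUpTo-cong n (λ i i<n → cong (nth a z) (m<n⇒m%n≡m i<n))) (applyUpTo-nth a z)

    rot≡window : ∀ s → s ≤ n → rot z s ≡ window s n
    rot≡window s s≤n = begin
      drop s z ++ take s z
        ≡⟨ cong (λ v → drop s v ++ take s v) (trans (sym window-0) (cong (window 0) (sym s+k≡n))) ⟩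
      drop s (window 0 (s + k)) ++ take s (window 0 (s + k))
        ≡⟨ cong₂ _++_ (drop-applyUpTo ω s k) (take-applyUpTo ω (m≤m+n s k)) ⟩
      window s k ++ window 0 s
        ≡⟨ cong (window s k ++_) (window-mod 0 (s + k) s 0≡s+k) ⟩
      window s k ++ window (s + k) s
        ≡⟨ window-++ s k s ⟨
      window s (k + s)
        ≡⟨ cong (window s) (trans (+-comm k s) s+k≡n) ⟩
      window s n ∎
      where
      open ≡-Reasoning
      k : ℕ
      k = n ∸ s
      s+k≡n : s + k ≡ n
      s+k≡n = m+[n∸m]≡n s≤n
      0≡s+k : 0 % n ≡ (s + k) % n
      0≡s+k = sym (trans (cong (_% n) s+k≡n) (n%n≡0 n))

    concat-replicate-window : ∀ x k → concat (replicate k (window x n)) ≡ window x (k * n)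
    concat-replicate-window x zero    = refl
    concat-replicate-window x (suc k) = begin
      window x n ++ concat (replicate k (window x n))
        ≡⟨ cong (window x n ++_) (concat-replicate-window x k) ⟩
      window x n ++ window x (k * n)
        ≡⟨ cong (window x n ++_) (window-mod x (x + n) (k * n) (sym ([m+n]%n≡m%n x n))) ⟩
      window x n ++ window (x + n) (k * n)
        ≡⟨ window-++ x n (k * n) ⟨
      window x (n + k * n) ∎
      where open ≡-Reasoning

    pw-rot : ∀ s → s ≤ n → ∀ m → pw (rot z s) m ≡ window s m
    pw-rot s s≤n m = begin
      take m (concat (replicate m (rot z s)))
        ≡⟨ cong (λ v → take m (concat (replicate m v))) (rot≡window s s≤n) ⟩
      take m (concat (replicate m (window s n)))
        ≡⟨ cong (take m) (concat-replicate-window s m) ⟩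
      take m (window s (m * n))
        ≡⟨ take-applyUpTo (ω ∘ (s +_)) (m≤m*n m n) ⟩
      window s m ∎
      where open ≡-Reasoning

    length-rot : ∀ s → s ≤ n → length (rot z s) ≡ n
    length-rot s s≤n = trans (cong length (rot≡window s s≤n)) (length-applyUpTo (ω ∘ (s +_)) n)

    occurs : ℕ → ℕ → Bool
    occurs M s = does (mem? _≟_ (window s M) (F w))

    occurs⇒IsFactor : ∀ M s → occurs M s ≡ true → IsFactor (window s M) w
    occurs⇒IsFactor M s = ∈F⇒IsFactor w ∘ does≡true⇒ (mem? _≟_ (window s M) (F w))

    window-infix : ∀ s d p m {M} → IsFactor (window s M) w → (s + d) % n ≡ p % n → d + m ≤ M →
                   IsFactor (window p m) w
    window-infix s d p m s-factor s+d≡p d+m≤M =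
      subst (λ v → IsFactor v w)
        (trans (applyUpTo-cong m (λ i _ → cong ω (sym (+-assoc s d i))))
               (window-mod (s + d) p m s+d≡p))
        (IsFactor-trans (applyUpTo-infix (ω ∘ (s +_)) d+m≤M) s-factor)

    -- Only n ∸ k residues s have window s M missing from w, so some s lies at cyclic distance
    -- d ≤ n ∸ k before p; since d + m ≤ M, window s M contains window p m.
    coverage : ∀ M p m → 1 ≤ count (occurs M) n → m + n ≤ count (occurs M) n + M →
               IsFactor (window p m) w
    coverage M p m 1≤k m+n≤k+M = covered-by (count>⇒∃true≥ (occurs M ∘ shift) n (k ∸ 1) k∸1<k)
      where
      k : ℕ
      k = count (occurs M) n

      shift : ℕ → ℕ
      shift e = (suc p + e) % n

      k∸1<k : k ∸ 1 < count (occurs M ∘ shift) n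
      k∸1<k = subst (k ∸ 1 <_) (sym (count-rotate (occurs M) n (suc p))) (∸-monoʳ-< (s≤s z≤n) 1≤k)

      lands-on-p : ∀ e → e < n → (shift e + (n ∸ suc e)) % n ≡ p % n
      lands-on-p e e<n = begin
        (shift e + (n ∸ suc e)) % n
          ≡⟨ mod-+-cong (shift e) (suc p + e) (n ∸ suc e) n (m%n%n≡m%n (suc p + e) n) ⟩
        (suc p + e + (n ∸ suc e)) % n
          ≡⟨ cong (λ j → (j + (n ∸ suc e)) % n) (sym (+-suc p e)) ⟩
        (p + suc e + (n ∸ suc e)) % n
          ≡⟨ cong (_% n) (+-assoc p (suc e) (n ∸ suc e)) ⟩
        (p + (suc e + (n ∸ suc e))) % n
          ≡⟨ cong (λ j → (p + j) % n) (m+[n∸m]≡n e<n) ⟩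
        (p + n) % n
          ≡⟨ [m+n]%n≡m%n p n ⟩
        p % n ∎
        where open ≡-Reasoning

      fits : ∀ e → k ∸ 1 ≤ e → e < n → n ∸ suc e + m ≤ M
      fits e k∸1≤e e<n = +-cancelˡ-≤ (suc e) (n ∸ suc e + m) M (begin
        suc e + (n ∸ suc e + m)   ≡⟨ +-assoc (suc e) (n ∸ suc e) m ⟨
        suc e + (n ∸ suc e) + m   ≡⟨ cong (_+ m) (m+[n∸m]≡n e<n) ⟩
        n + m                     ≡⟨ +-comm n m ⟩
        m + n                     ≤⟨ m+n≤k+M ⟩
        k + M                     ≤⟨ +-monoˡ-≤ M (≤-trans (m≤n+m∸n k 1) (s≤s k∸1≤e)) ⟩
        suc e + M                 ∎)
        where open ≤-Reasoning

      covered-by : ∃[ e ] k ∸ 1 ≤ e × e < n × occurs M (shift e) ≡ true → IsFactor (window p m) w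
      covered-by (e , k∸1≤e , e<n , occurs-e) =
        window-infix (shift e) (n ∸ suc e) p m (occurs⇒IsFactor M (shift e) occurs-e)
          (lands-on-p e e<n) (fits e k∸1≤e e<n)

    occurs⇒≤length : ∀ M → 1 ≤ count (occurs M) n → M ≤ length w
    occurs⇒≤length M 1≤k with s , _ , _ , occurs-s ← count>⇒∃true≥ (occurs M) n 0 1≤k = begin
      M                    ≡⟨ length-applyUpTo (ω ∘ (s +_)) M ⟨
      length (window s M)  ≤⟨ IsFactor⇒length≤ (occurs⇒IsFactor M s occurs-s) ⟩
      length w             ∎
      where open ≤-Reasoning

    -- Each of the lengths m = n, …, n + X + k gives a circuit.
    csCount> : ∀ {M} X → n + n + X ≡ M → 1 ≤ count (occurs M) n →
               X + count (occurs M) n < csCount w z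
    csCount> {M} X M≡ 1≤k = begin
      suc (X + k)                ≤⟨ run≤count (does ∘ Q?) n (suc (X + k)) (suc N) circuit range ⟩
      count (does ∘ Q?) (suc N)  ≡⟨ length-filter-applyUpTo Q? (λ m → m) (suc N) ⟨
      csCount w z                ∎
      where
      open ≤-Reasoning
      k N : ℕ
      k = count (occurs M) n
      N = length w

      Q? : Decidable (λ m → n ≤ m × All (λ x → pw x m ∈ F w) (conj z))
      Q? m = (n ≤? m) ×-dec ConjPowFactors? w z m

      circuit : ∀ j → j < suc (X + k) → does (Q? (n + j)) ≡ true
      circuit j j<1+X+k = dec-true (Q? (n + j)) (m≤m+n n j ,
        subst (All (λ x → pw x (n + j) ∈ F w)) (sym (map-upTo (rot z) n))
          (applyUpTo⁺₁ (rot z) n (λ {s} s<n → IsFactor⇒∈F (subst (λ v → IsFactor v w)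
            (sym (pw-rot s (<⇒≤ s<n) (n + j))) (coverage M s (n + j) 1≤k fits)))))
        where
        rearrange : ∀ n X k → n + (X + k) + n ≡ k + (n + n + X)
        rearrange = solve-∀

        fits : n + j + n ≤ k + M
        fits = begin
          n + j + n        ≤⟨ +-monoˡ-≤ n (+-monoʳ-≤ n (m<1+n⇒m≤n j<1+X+k)) ⟩
          n + (X + k) + n  ≡⟨ rearrange n X k ⟩
          k + (n + n + X)  ≡⟨ cong (k +_) M≡ ⟩
          k + M            ∎

      range : n + suc (X + k) ≤ suc N
      range = begin
        n + suc (X + k)    ≡⟨ +-suc n (X + k) ⟩
        suc (n + (X + k))  ≤⟨ s≤s (+-monoʳ-≤ n (+-monoʳ-≤ X (count≤ (occurs M) n))) ⟩
        suc (n + (X + n))  ≡⟨ cong suc (trans (rearrange n X) M≡) ⟩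
        suc M              ≤⟨ s≤s (occurs⇒≤length M 1≤k) ⟩
        suc N              ∎
        where
        rearrange : ∀ n X → n + (X + n) ≡ n + n + X
        rearrange = solve-∀

    -- k_r: the number of conjugates x of z with x^{2(r+1)} ∈ F(w)
    squares : ℕ → ℕ
    squares r = count (occurs (2 * suc r * n)) n

    sqCount≤ : sqCount w z ≤ sum (applyUpTo squares (length w))
    sqCount≤ = begin
      sqCount w z
        ≤⟨ length-deduplicate _≟_ (filter P? (concatMap h (upTo N))) ⟩
      length (filter P? (concatMap h (upTo N)))
        ≡⟨ length-filter-concatMap P? h (upTo N) ⟩
      sum (map (length ∘ filter P? ∘ h) (upTo N))
        ≡⟨ cong sum (map-cong squares-of-exponent (upTo N)) ⟩
      sum (map squares (upTo N))
        ≡⟨ cong sum (map-upTo squares N) ⟩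
      sum (applyUpTo squares N) ∎
      where
      open ≤-Reasoning
      N : ℕ
      N = length w

      P? : Decidable (_∈ F w)
      P? u = mem? _≟_ u (F w)

      h : ℕ → List Word
      h r = map (λ x → pw x (2 * suc r * length x)) (conj z)

      squares-of-exponent : ∀ r → length (filter P? (h r)) ≡ squares r
      squares-of-exponent r = begin-equality
        length (filter P? (map f (map (rot z) (upTo n))))
          ≡⟨ cong (length ∘ filter P? ∘ map f) (map-upTo (rot z) n) ⟩
        length (filter P? (map f (applyUpTo (rot z) n)))
          ≡⟨ cong (length ∘ filter P?) (map-applyUpTo (rot z) f n) ⟩
        length (filter P? (applyUpTo (f ∘ rot z) n))
          ≡⟨ length-filter-applyUpTo P? (f ∘ rot z) n ⟩
        count (does ∘ P? ∘ f ∘ rot z) n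
          ≡⟨ count-cong n (λ s s<n → cong (does ∘ P?) (square≡window s (<⇒≤ s<n))) ⟩
        squares r ∎
        where
        f : Word → Word
        f x = pw x (2 * suc r * length x)

        square≡window : ∀ s → s ≤ n → f (rot z s) ≡ window s (2 * suc r * n)
        square≡window s s≤n = trans (cong (λ l → pw (rot z s) (2 * suc r * l)) (length-rot s s≤n))
                                    (pw-rot s s≤n (2 * suc r * n))

    sqCount-ratio : sqCount w z * (n + 1) ≤ n * csCount w z
    sqCount-ratio with sum-≤-last-positive squares (length w) (λ r → count≤ (occurs (2 * suc r * n)) n)
    ... | inj₁ sum≡0            =
      ≤-trans (*-monoˡ-≤ (n + 1) (≤-trans sqCount≤ (≤-reflexive sum≡0))) z≤n
    ... | inj₂ (R , 1≤k , sum≤) =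
      ratio-bound {X = R * n} (count≤ (occurs (2 * suc R * n)) n) (≤-trans sqCount≤ sum≤)
        (csCount> (R * n + R * n) (double R n) 1≤k)
      where
      double : ∀ R n → n + n + (R * n + R * n) ≡ 2 * suc R * n
      double = solve-∀

lemma8 : {A : Set} (_≺_ : A → A → Set) (sto : IsStrictTotalOrder _≡_ _≺_)
         (w z : List A) →
         Words.IsLyndonFactor _≺_ sto w z →
         1 ≤ Words.csCount _≺_ sto w z →
         Words.sqCount _≺_ sto w z * (length z + 1) ≤ length z * Words.csCount _≺_ sto w z
lemma8 _≺_ sto w []       ((z≢[] , _) , _) _ = ⊥-elim (z≢[] refl)
lemma8 _≺_ sto w (a ∷ as) _                  _ = SquaresOfConjugates.sqCount-ratio _≺_ sto w a as
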